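{- Consider the Learned DFS Ordering (LDFS) algorithm, as described in the context, run on an insertion sequence of $m$ edges whose final graph $G_m$ is acyclic. For any vertex $v$, let $\ell_0(v)$ and $\ell_m(v)$ denote its initial level and its level after all $m$ insertions. Then $\ell_m(v)-\ell_0(v)\le 2\eta$.
   Context: Incremental topological ordering: vertex set $V$, $|V|=n$, initially no edges; directed edges $e_1,\dots,e_m$ arrive one at a time; $G_t$ is the graph after $t$ insertions, and $G_m$ is the final graph. A vertex $x$ is an ancestor of $y$ if there is a directed path from $x$ to $y$ (every vertex is its own ancestor); if $(x,y)$ is an edge, $x$ is a parent of $y$ and $y$ a child of $x$. An edge $(x,y)$ is an ancestor edge of a vertex $w$ if $y$ is an ancestor of $w$. Let $\alpha(v)$ be the number of ancestor edges of $v$ in $G_m$. The algorithm receives predictions $\tilde{\alpha}(v)$ for each $v$; the error is $\eta=\max_{v\in V}|\tilde{\alpha}(v)-\alpha(v)|$, assumed to be at least $1$. The LDFS algorithm maintains, for each vertex $v$, a level $\ell(v)$, initialized to $\ell(v)=\tilde{\alpha}(v)$ (plus auxiliary data: a list $in(v)$ of parents at the same level, integers $j(v)$ and a global counter $a$, which do not affect levels). On insertion of an edge $(u,v)$: if $\ell(u)>\ell(v)$, set $\ell(v)\leftarrow\ell(u)$ and then perform a forward search: for each child $w$ of a vertex $x$ whose level was just raised, if $\ell(x)>\ell(w)$, set $\ell(w)\leftarrow\ell(x)$ and recurse on $w$. No other operation changes levels. (If $\ell(u)=\ell(v)$, a reverse DFS along same-level parent edges is used to detect cycles, and the $j$-values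 are updated to break ties within a level.) -}

module Defs where

open import Data.Nat using (ℕ; _<_; _≤_; _⊔_; ∣_-_∣)
open import Data.Fin using (Fin; _≟_)
open import Data.Fin.Base using ()
open import Data.List using (List; []; _∷_; _++_; [_]; length; map; foldr; allFin)
open import Data.List.Membership.Propositional using (_∈_)
open import Data.List.Relation.Unary.Unique.Propositional using (Unique)
open import Data.Product using (Σ; _×_; _,_; proj₂)
open import Data.Bool using (if_then_else_)
open import Relation.Nullary using (¬_)
open import Relation.Nullary.Decidable using (⌊_⌋)
open import Relation.Binary.PropositionalEquality using (_≡_)
open import Relation.Binary.Construct.Closure.ReflexiveTransitive using (Star)
open import Function.Bundles using (_⇔_)

Edge : ℕ → Set
Edge n = Fin n × Fin n

-- A graph is given by the list of edges inserted so far (membership = edge set).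
Graph : ℕ → Set
Graph n = List (Edge n)

Levels : ℕ → Set
Levels n = Fin n → ℕ

EdgeOf : ∀ {n} → Graph n → Fin n → Fin n → Set
EdgeOf G x y = (x , y) ∈ G

Ancestor : ∀ {n} → Graph n → Fin n → Fin n → Set
Ancestor G = Star (EdgeOf G)

Acyclic : ∀ {n} → Graph n → Set
Acyclic G = ∀ x y → EdgeOf G x y → ¬ Ancestor G y x

NumAncestorEdges : ∀ {n} → Graph n → Fin n → ℕ → Set
NumAncestorEdges {n} G v k =
  Σ (List (Edge n)) λ L →
    Unique L × (∀ e → (e ∈ L) ⇔ (e ∈ G × Ancestor G (proj₂ e) v)) × length L ≡ k

maxError : ∀ {n} → (Fin n → ℕ) → (Fin n → ℕ) → ℕ
maxError {n} α̃ α = foldr _⊔_ 0 (map (λ v → ∣ α̃ v - α v ∣) (allFin n))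

setLevel : ∀ {n} → Levels n → Fin n → ℕ → Levels n
setLevel ℓ w k y = if ⌊ y ≟ w ⌋ then k else ℓ y

-- Search G ℓ R ℓ' : starting from levels ℓ with
-- R the list of vertices whose level has been raised in this search, the
-- search may terminate with levels ℓ'.  The search terminates once every child of every raised vertex has
-- been examined, i.e. no raised vertex has a child of smaller level.
data Search {n} (G : Graph n) : Levels n → List (Fin n) → Levels n → Set where
  stop : ∀ {ℓ R} →
         (∀ x w → x ∈ R → EdgeOf G x w → ℓ x ≤ ℓ w) →
         Search G ℓ R ℓ
  step : ∀ {ℓ R ℓ'} x w →
         x ∈ R → EdgeOf G x w → ℓ w < ℓ x →
         Search G (setLevel ℓ w (ℓ x)) (w ∷ R) ℓ' →
         Search G ℓ R ℓ'

-- Effect on levels of inserting edge (u , v), where G already contains it.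
-- If ℓ(u) ≤ ℓ(v) levels are unchanged (the same-level cycle check only
-- touches auxiliary data); otherwise ℓ(v) ← ℓ(u) followed by forward search.
data Insert {n} (G : Graph n) (u v : Fin n) : Levels n → Levels n → Set where
  noRaise : ∀ {ℓ} → ℓ u ≤ ℓ v → Insert G u v ℓ ℓ
  raise   : ∀ {ℓ ℓ'} → ℓ v < ℓ u →
            Search G (setLevel ℓ v (ℓ u)) (v ∷ []) ℓ' →
            Insert G u v ℓ ℓ'

data Exec {n} : Graph n → List (Edge n) → Levels n → Levels n → Set where
  done : ∀ {G ℓ} → Exec G [] ℓ ℓ
  next : ∀ {G u v es ℓ ℓ₁ ℓ'} →
         Insert (G ++ [ (u , v) ]) u v ℓ ℓ₁ →
         Exec (G ++ [ (u , v) ]) es ℓ₁ ℓ' →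
         Exec G ((u , v) ∷ es) ℓ ℓ'

-- Every level ever assigned is the initial level α̃(x) of some ancestor x
-- of the vertex, since a level only moves along an edge.  The number of
-- ancestor edges is monotone along ancestry, so α̃(x) ≤ α(x) + η ≤ α(v) + η
-- ≤ α̃(v) + 2η.
module Submission where

open import Defs
open import Data.Nat using (ℕ; _≤_; _+_; _*_; suc; z≤n; s≤s; _⊔_; ∣_-_∣)
open import Data.Nat.Properties
  using (≤-refl; ≤-trans; m≤m⊔n; m≤n⊔m; m≤n+∣m-n∣; m≤n+∣n-m∣;
         +-mono-≤; +-monoˡ-≤; +-monoʳ-≤; +-assoc; +-identityʳ; module ≤-Reasoning)
open import Data.Fin using (Fin; _≟_)
open import Data.List using (List; []; _∷_; _++_; [_]; length; foldr)
open import Data.List.Properties using (++-assoc; length-removeAt′)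
open import Data.List.Membership.Propositional using (_∈_)
open import Data.List.Membership.Propositional.Properties
  using (∈-allFin; ∈-map⁺; ∈-++⁺ˡ; ∈-++⁺ʳ; ∈-++⁻)
open import Data.List.Relation.Binary.Subset.Propositional using (_⊆_)
open import Data.List.Relation.Unary.Any using (here; there; index; _─_)
open import Data.List.Relation.Unary.All as All using (All)
open import Data.List.Relation.Unary.AllPairs using (_∷_)
open import Data.List.Relation.Unary.Unique.Propositional using (Unique)
open import Data.Product using (∃; _×_; _,_; proj₁; proj₂)
open import Data.Sum using (inj₁; inj₂)
open import Data.Empty using (⊥-elim)
open import Relation.Nullary using (yes; no)
open import Relation.Binary.PropositionalEquality using (_≡_; _≢_; refl; cong; subst; sym)
open import Relation.Binary.Construct.Closure.ReflexiveTransitive using (ε; _◅_; _◅◅_)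
open import Function.Bundles using (Equivalence)

module _ {A : Set} where

  ∈-─⁺ : ∀ {x z} {ys : List A} (p : x ∈ ys) → z ∈ ys → x ≢ z → z ∈ (ys ─ p)
  ∈-─⁺ (here refl) (here refl) x≢z = ⊥-elim (x≢z refl)
  ∈-─⁺ (here refl) (there q)   x≢z = q
  ∈-─⁺ (there p)   (here eq)   x≢z = here eq
  ∈-─⁺ (there p)   (there q)   x≢z = there (∈-─⁺ p q x≢z)

  Unique-⊆⇒length≤ : ∀ {xs ys : List A} → Unique xs → xs ⊆ ys → length xs ≤ length ys
  Unique-⊆⇒length≤ {[]}     _                xs⊆ys = z≤n
  Unique-⊆⇒length≤ {x ∷ xs} {ys} (x≢xs ∷ !xs) xs⊆ys =
    subst (suc (length xs) ≤_) (sym (length-removeAt′ ys (index x∈ys)))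
      (s≤s (Unique-⊆⇒length≤ !xs
        (λ z∈xs → ∈-─⁺ x∈ys (xs⊆ys (there z∈xs)) (All.lookup x≢xs z∈xs))))
    where
    x∈ys = xs⊆ys (here refl)

∈⇒≤foldr-⊔ : ∀ {x xs} → x ∈ xs → x ≤ foldr _⊔_ 0 xs
∈⇒≤foldr-⊔ (here refl) = m≤m⊔n _ _
∈⇒≤foldr-⊔ (there p)   = ≤-trans (∈⇒≤foldr-⊔ p) (m≤n⊔m _ _)

error≤maxError : ∀ {n} (α̃ α : Fin n → ℕ) v → ∣ α̃ v - α v ∣ ≤ maxError α̃ α
error≤maxError α̃ α v = ∈⇒≤foldr-⊔ (∈-map⁺ (λ w → ∣ α̃ w - α w ∣) (∈-allFin v))

NumAncestorEdges-mono : ∀ {n} {G : Graph n} {x v a b} → Ancestor G x v →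
  NumAncestorEdges G x a → NumAncestorEdges G v b → a ≤ b
NumAncestorEdges-mono x↝v (Lx , !Lx , Lx⇔ , refl) (Lv , _ , Lv⇔ , refl) =
  Unique-⊆⇒length≤ !Lx λ {e} e∈Lx →
    let e∈G , y↝x = Equivalence.to (Lx⇔ e) e∈Lx
    in Equivalence.from (Lv⇔ e) (e∈G , y↝x ◅◅ x↝v)

module _ {n} (F : Graph n) (ℓ₀ : Levels n) where

  LevelsFromAncestors : Levels n → Set
  LevelsFromAncestors ℓ = ∀ w → ∃ λ x → Ancestor F x w × ℓ w ≤ ℓ₀ x

  setLevel-fromAncestors : ∀ {ℓ x w} → EdgeOf F x w →
    LevelsFromAncestors ℓ → LevelsFromAncestors (setLevel ℓ w (ℓ x))
  setLevel-fromAncestors {ℓ} {x} {w} x→w inv y with y ≟ w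
  ... | yes refl = let a , a↝x , ℓx≤ = inv x in a , a↝x ◅◅ (x→w ◅ ε) , ℓx≤
  ... | no _     = inv y

  Search-fromAncestors : ∀ {G ℓ R ℓ'} → Search G ℓ R ℓ' → G ⊆ F →
    LevelsFromAncestors ℓ → LevelsFromAncestors ℓ'
  Search-fromAncestors (stop _)            _   inv = inv
  Search-fromAncestors (step _ _ _ x→w _ s) G⊆F inv =
    Search-fromAncestors s G⊆F (setLevel-fromAncestors (G⊆F x→w) inv)

  Insert-fromAncestors : ∀ {G u v ℓ ℓ'} → Insert G u v ℓ ℓ' → G ⊆ F → EdgeOf G u v →
    LevelsFromAncestors ℓ → LevelsFromAncestors ℓ'
  Insert-fromAncestors (noRaise _) _   _   inv = inv
  Insert-fromAncestors (raise _ s) G⊆F u→v inv =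
    Search-fromAncestors s G⊆F (setLevel-fromAncestors (G⊆F u→v) inv)

  Exec-fromAncestors : ∀ {G es ℓ ℓ'} → Exec G es ℓ ℓ' → G ++ es ⊆ F →
    LevelsFromAncestors ℓ → LevelsFromAncestors ℓ'
  Exec-fromAncestors done _ inv = inv
  Exec-fromAncestors {G} (next {u = u} {v} {es} ins exec) G++es⊆F inv =
    Exec-fromAncestors exec (λ {e} p → G++es⊆F (subst (e ∈_) (++-assoc G [ (u , v) ] es) p))
      (Insert-fromAncestors ins G+uv⊆F (∈-++⁺ʳ G (here refl)) inv)
    where
    G+uv⊆F : G ++ [ (u , v) ] ⊆ F
    G+uv⊆F p with ∈-++⁻ G p
    ... | inj₁ e∈G        = G++es⊆F (∈-++⁺ˡ e∈G)
    ... | inj₂ (here refl) = G++es⊆F (∈-++⁺ʳ G (here refl))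

lemma3p2 : ∀ {n} (es : List (Edge n)) (α̃ α : Fin n → ℕ) (η : ℕ) (ℓₘ : Levels n) →
    Acyclic es →
    (∀ v → NumAncestorEdges es v (α v)) →
    η ≡ maxError α̃ α →
    1 ≤ η →
    Exec [] es α̃ ℓₘ →
    ∀ v → ℓₘ v ≤ α̃ v + 2 * η
lemma3p2 es α̃ α η ℓₘ _ numα refl _ exec v = begin
  ℓₘ v                      ≤⟨ ℓₘv≤α̃x ⟩
  α̃ x                       ≤⟨ m≤n+∣m-n∣ (α̃ x) (α x) ⟩
  α x + ∣ α̃ x - α x ∣       ≤⟨ +-mono-≤ (NumAncestorEdges-mono x↝v (numα x) (numα v)) (err≤η x) ⟩
  α v + η                   ≤⟨ +-monoˡ-≤ η (m≤n+∣n-m∣ (α v) (α̃ v)) ⟩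
  α̃ v + ∣ α̃ v - α v ∣ + η   ≤⟨ +-monoˡ-≤ η (+-monoʳ-≤ (α̃ v) (err≤η v)) ⟩
  α̃ v + η + η               ≡⟨ +-assoc (α̃ v) η η ⟩
  α̃ v + (η + η)             ≡⟨ cong (λ k → α̃ v + (η + k)) (sym (+-identityʳ η)) ⟩
  α̃ v + 2 * η               ∎
  where
  open ≤-Reasoning
  fromAncestors = Exec-fromAncestors es α̃ exec (λ p → p) (λ w → w , ε , ≤-refl) v
  x = proj₁ fromAncestors
  x↝v = proj₁ (proj₂ fromAncestors)
  ℓₘv≤α̃x = proj₂ (proj₂ fromAncestors)
  err≤η = error≤maxError α̃ α
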